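{- For every integer $t\geq 2$, every (finite, simple) graph with average degree at least $2^{t-2}$ has a dominating $K_t$-model.
   Context: A dominating $K_t$-model in a graph $G$ is a sequence $(T_1,\dots,T_t)$ of pairwise disjoint non-empty connected subgraphs of $G$ such that for all $1\le i<j\le t$, every vertex of $T_j$ has a neighbour in $T_i$. The average degree of a graph $G$ with at least one vertex is $2|E(G)|/|V(G)|$. -}

module Defs where

open import Data.Nat using (ℕ; zero; suc; _+_; _*_; _≤_; _<_; _^_; _∸_)
open import Data.Bool using (Bool; true; false)
open import Data.Fin using (Fin; toℕ)
open import Data.Fin.Subset using (Subset; _∈_)
open import Data.List using (List; length; filter; allFin; concatMap)
open import Data.Product using (Σ; _×_; _,_; ∃)
open import Relation.Binary.PropositionalEquality using (_≡_)
open import Relation.Nullary using (¬_)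
open import Data.Fin using (_<?_)

record Graph (n : ℕ) : Set where
  field
    adj   : Fin n → Fin n → Bool
    sym   : ∀ u v → adj u v ≡ adj v u
    irrefl : ∀ v → adj v v ≡ false

open Graph public

Adj : ∀ {n} → Graph n → Fin n → Fin n → Set
Adj G u v = adj G u v ≡ true

edges : ∀ {n} → Graph n → List (Fin n × Fin n)
edges {n} G =
  filter (λ p → Data.Bool._≟_ (adj G (Data.Product.proj₁ p) (Data.Product.proj₂ p)) true)
    (filter (λ p → Data.Product.proj₁ p <? Data.Product.proj₂ p)
      (concatMap (λ u → Data.List.map (λ v → (u , v)) (allFin n)) (allFin n)))

numEdges : ∀ {n} → Graph n → ℕ
numEdges G = length (edges G)

data WalkIn {n} (G : Graph n) (S : Subset n) : Fin n → Fin n → Set where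
  here : ∀ {u} → u ∈ S → WalkIn G S u u
  step : ∀ {u w v} → u ∈ S → Adj G u w → WalkIn G S w v → WalkIn G S u v

-- The subgraph with vertex set S (using the edges of G inside S) is connected.
-- (A vertex set carries a connected subgraph iff its induced subgraph is connected.)
ConnectedIn : ∀ {n} → Graph n → Subset n → Set
ConnectedIn G S = ∀ u v → u ∈ S → v ∈ S → WalkIn G S u v

NonEmpty : ∀ {n} → Subset n → Set
NonEmpty S = ∃ λ v → v ∈ S

record DominatingModel {n} (G : Graph n) (t : ℕ) : Set where
  field
    T         : Fin t → Subset n
    nonEmpty  : ∀ i → NonEmpty (T i)
    connected : ∀ i → ConnectedIn G (T i)
    disjoint  : ∀ i j → ¬ (i ≡ j) → ∀ v → v ∈ T i → ¬ (v ∈ T j)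
    dominating : ∀ i j → toℕ i < toℕ j → ∀ v → v ∈ T j →
                 ∃ λ u → u ∈ T i × Adj G u v

{-# OPTIONS --safe #-}
-- Write degreeSum S for the sum of the degrees in G[S], twice its number of edges.
-- By induction on k, every non-empty S with 2^k |S| ≤ degreeSum S carries a dominating
-- K_(k+2)-model; the theorem is the case S = V(G). For k = 0, G[S] has an edge. For
-- k + 1, let d = 2^k and grow a connected root T from a single vertex, keeping a rest
-- R ⊆ S disjoint from T and a core D ⊆ R of vertices with a neighbour in T, subject to
-- the potential inequality 2d(|R| + 1) ≤ degreeSum R + 2|D|. A core vertex y of degree
-- < d in G[D] is moved into T: degreeSum R drops by 2 deg_R(y), while D loses y but
-- gains the deg_R(y) - deg_D(y) neighbours of y in R \ D, so the inequality survives.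
-- If D becomes empty, the inequality gives 2d|R| < degreeSum R and we restart inside R.
-- As |R| decreases, this ends with D non-empty of minimum degree ≥ d, so
-- d|D| ≤ degreeSum D; by induction D carries a dominating K_(k+2)-model, and T in
-- front of it gives a dominating K_(k+3)-model in S.
module Submission where

open import Data.Bool using (Bool; true; false; _∧_; _≟_)
open import Data.Fin using (Fin; zero; suc; toℕ)
open import Data.Fin.Properties using (<-cmp; any?) renaming (_<?_ to _<ᶠ?_)
open import Data.Fin.Subset using (Subset; inside; outside; _∈_; _∉_; _⊆_; _∪_; _∩_; _─_; _-_; ⁅_⁆; ⊤; ∣_∣; Empty)
open import Data.Fin.Subset.Properties using (_∈?_; nonempty?; ∈⊤; x∈⁅x⁆; x∈⁅y⁆⇒x≡y; p⊆p∪q; q⊆p∪q; x∈p∪q⁻; p∩q⊆p; x∈p∩q⁺; x∈p∩q⁻; p─⊥≡p; p─q⊆p; x∈p∧x∉q⇒x∈p─q; x∈p∧x≢y⇒x∈p-y; p⊆q⇒∣p∣≤∣q∣; x∈p⇒∣p-x∣<∣p∣; ∣⁅x⁆∣≡1; ∣⊥∣≡0; ∣⊤∣≡n; Empty-unique)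
open import Data.List as List using (List; []; _∷_; _++_; length; filter; concat; concatMap; allFin)
open import Data.List.Properties using (filter-++; length-++; map-tabulate; tabulate-cong)
open import Data.Nat using (ℕ; zero; suc; _+_; _*_; _^_; _∸_; _≤_; _<_; z≤n; s≤s; _<?_)
open import Data.Nat.Induction using (<-wellFounded)
open import Data.Nat.Properties using (+-0-commutativeMonoid; +-commutativeSemigroup; +-assoc; +-comm; +-identityʳ; +-suc; *-identityˡ; *-zeroʳ; *-suc; ≤-trans; n≤1+n; m≤n⇒m≤1+n; ≮⇒≥; +-mono-≤; +-monoʳ-≤; +-cancelʳ-≤; *-monoʳ-≤; m^n>0; module ≤-Reasoning)
open import Data.Nat.Tactic.RingSolver using (solve-∀)
open import Algebra.Properties.CommutativeMonoid.Sum +-0-commutativeMonoid using (sum-syntax; ∑-distrib-+; ∑-comm; sum-cong-≗)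
open import Algebra.Properties.CommutativeSemigroup +-commutativeSemigroup using (interchange; x∙yz≈y∙xz)
open import Data.Product using (∃; Σ-syntax; _×_; _,_; proj₁; proj₂)
open import Data.Sum using ([_,_]′; inj₁; inj₂)
open import Data.Vec using ([]; _∷_; here; there; tabulate)
open import Data.Vec.Properties using ([]=⇒lookup; lookup∘tabulate)
open import Defs renaming (sym to adj-sym; irrefl to adj-irrefl)
open import Function using (_∘_; id)
open import Induction.WellFounded using (Acc; acc)
open import Relation.Binary.Definitions using (tri<; tri≈; tri>)
open import Relation.Binary.PropositionalEquality using (_≡_; _≢_; _≗_; refl; sym; trans; cong; cong₂; subst; subst₂; module ≡-Reasoning)
open import Relation.Nullary using (¬_; contradiction; does; yes; no; _×-dec_)
open import Relation.Nullary.Decidable using (dec-true; dec-false)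
open import Relation.Unary using (Decidable)
open import Relation.Unary.Properties using (_∩?_)

x∈p─q⇒x∉q : ∀ {n} {x : Fin n} (p q : Subset n) → x ∈ p ─ q → x ∉ q
x∈p─q⇒x∉q (_ ∷ p) (outside ∷ q) here        ()
x∈p─q⇒x∉q (_ ∷ p) (_       ∷ q) (there x∈) (there x∈q) = x∈p─q⇒x∉q p q x∈ x∈q

∣p∪q∣+∣p∩q∣≡∣p∣+∣q∣ : ∀ {n} (p q : Subset n) → ∣ p ∪ q ∣ + ∣ p ∩ q ∣ ≡ ∣ p ∣ + ∣ q ∣
∣p∪q∣+∣p∩q∣≡∣p∣+∣q∣ []            []            = refl
∣p∪q∣+∣p∩q∣≡∣p∣+∣q∣ (outside ∷ p) (outside ∷ q) = ∣p∪q∣+∣p∩q∣≡∣p∣+∣q∣ p q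
∣p∪q∣+∣p∩q∣≡∣p∣+∣q∣ (inside  ∷ p) (outside ∷ q) = cong suc (∣p∪q∣+∣p∩q∣≡∣p∣+∣q∣ p q)
∣p∪q∣+∣p∩q∣≡∣p∣+∣q∣ (outside ∷ p) (inside  ∷ q) =
  trans (cong suc (∣p∪q∣+∣p∩q∣≡∣p∣+∣q∣ p q)) (sym (+-suc ∣ p ∣ ∣ q ∣))
∣p∪q∣+∣p∩q∣≡∣p∣+∣q∣ (inside  ∷ p) (inside  ∷ q) = cong suc (begin
  ∣ p ∪ q ∣ + suc ∣ p ∩ q ∣  ≡⟨ +-suc ∣ p ∪ q ∣ ∣ p ∩ q ∣ ⟩
  suc (∣ p ∪ q ∣ + ∣ p ∩ q ∣) ≡⟨ cong suc (∣p∪q∣+∣p∩q∣≡∣p∣+∣q∣ p q) ⟩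
  suc (∣ p ∣ + ∣ q ∣)         ≡⟨ +-suc ∣ p ∣ ∣ q ∣ ⟨
  ∣ p ∣ + suc ∣ q ∣           ∎)
  where open ≡-Reasoning

∣p∣≤∣p─q∣+∣q∣ : ∀ {n} (p q : Subset n) → ∣ p ∣ ≤ ∣ p ─ q ∣ + ∣ q ∣
∣p∣≤∣p─q∣+∣q∣ []            []            = z≤n
∣p∣≤∣p─q∣+∣q∣ (outside ∷ p) (outside ∷ q) = ∣p∣≤∣p─q∣+∣q∣ p q
∣p∣≤∣p─q∣+∣q∣ (inside  ∷ p) (outside ∷ q) = s≤s (∣p∣≤∣p─q∣+∣q∣ p q)
∣p∣≤∣p─q∣+∣q∣ (outside ∷ p) (inside  ∷ q) =
  subst (∣ p ∣ ≤_) (sym (+-suc ∣ p ─ q ∣ ∣ q ∣)) (m≤n⇒m≤1+n (∣p∣≤∣p─q∣+∣q∣ p q))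
∣p∣≤∣p─q∣+∣q∣ (inside  ∷ p) (inside  ∷ q) =
  subst (suc ∣ p ∣ ≤_) (sym (+-suc ∣ p ─ q ∣ ∣ q ∣)) (s≤s (∣p∣≤∣p─q∣+∣q∣ p q))

x∈p⇒⁅x⁆⊆p : ∀ {n} {x : Fin n} {p : Subset n} → x ∈ p → ⁅ x ⁆ ⊆ p
x∈p⇒⁅x⁆⊆p {x = x} {p} x∈p y∈⁅x⁆ = subst (_∈ p) (sym (x∈⁅y⁆⇒x≡y x y∈⁅x⁆)) x∈p

p⊆r⇒q⊆r⇒p∪q⊆r : ∀ {n} {p q r : Subset n} → p ⊆ r → q ⊆ r → p ∪ q ⊆ r
p⊆r⇒q⊆r⇒p∪q⊆r {p = p} {q} p⊆r q⊆r x∈p∪q = [ p⊆r , q⊆r ]′ (x∈p∪q⁻ p q x∈p∪q)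

∣p∣+∣q∩r∣≤∣p∪q∩r-x∣+1+∣p∩r∣ : ∀ {n} (p q r : Subset n) x →
                                ∣ p ∣ + ∣ q ∩ r ∣ ≤ ∣ (p ∪ q ∩ r) - x ∣ + 1 + ∣ p ∩ r ∣
∣p∣+∣q∩r∣≤∣p∪q∩r-x∣+1+∣p∩r∣ p q r x = begin
  ∣ p ∣ + ∣ q ∩ r ∣                               ≡⟨ ∣p∪q∣+∣p∩q∣≡∣p∣+∣q∣ p (q ∩ r) ⟨
  ∣ p ∪ q ∩ r ∣ + ∣ p ∩ (q ∩ r) ∣                 ≤⟨ +-mono-≤ (∣p∣≤∣p─q∣+∣q∣ (p ∪ q ∩ r) ⁅ x ⁆) (p⊆q⇒∣p∣≤∣q∣ p∩q∩r⊆p∩r) ⟩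
  ∣ (p ∪ q ∩ r) - x ∣ + ∣ ⁅ x ⁆ ∣ + ∣ p ∩ r ∣     ≡⟨ cong (λ k → ∣ (p ∪ q ∩ r) - x ∣ + k + ∣ p ∩ r ∣) (∣⁅x⁆∣≡1 x) ⟩
  ∣ (p ∪ q ∩ r) - x ∣ + 1 + ∣ p ∩ r ∣             ∎
  where
  open ≤-Reasoning
  p∩q∩r⊆p∩r : p ∩ (q ∩ r) ⊆ p ∩ r
  p∩q∩r⊆p∩r x∈ with x∈p∩q⁻ p (q ∩ r) x∈
  ... | x∈p , x∈q∩r = x∈p∩q⁺ (x∈p , proj₂ (x∈p∩q⁻ q r x∈q∩r))

χ : Bool → ℕ
χ true  = 1
χ false = 0

∑∈ : ∀ {n} → Subset n → (Fin n → ℕ) → ℕ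
∑∈ []            f = 0
∑∈ (inside  ∷ p) f = f zero + ∑∈ p (f ∘ suc)
∑∈ (outside ∷ p) f = ∑∈ p (f ∘ suc)

syntax ∑∈ p (λ x → e) = ∑[ x ∈ p ] e

∑∈-cong : ∀ {n} (p : Subset n) {f g : Fin n → ℕ} → f ≗ g → ∑∈ p f ≡ ∑∈ p g
∑∈-cong []            f≗g = refl
∑∈-cong (inside  ∷ p) f≗g = cong₂ _+_ (f≗g zero) (∑∈-cong p (f≗g ∘ suc))
∑∈-cong (outside ∷ p) f≗g = ∑∈-cong p (f≗g ∘ suc)

∑∈-distrib-+ : ∀ {n} (p : Subset n) (f g : Fin n → ℕ) →
               ∑[ x ∈ p ] (f x + g x) ≡ ∑∈ p f + ∑∈ p g
∑∈-distrib-+ []            f g = refl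
∑∈-distrib-+ (outside ∷ p) f g = ∑∈-distrib-+ p (f ∘ suc) (g ∘ suc)
∑∈-distrib-+ (inside  ∷ p) f g =
  trans (cong (f zero + g zero +_) (∑∈-distrib-+ p (f ∘ suc) (g ∘ suc)))
        (interchange (f zero) (g zero) (∑∈ p (f ∘ suc)) (∑∈ p (g ∘ suc)))

∑∈-remove : ∀ {n} {x : Fin n} (p : Subset n) (f : Fin n → ℕ) → x ∈ p → ∑∈ p f ≡ f x + ∑∈ (p - x) f
∑∈-remove (inside ∷ p) f here = cong (f zero +_) (cong (λ q → ∑∈ q (f ∘ suc)) (sym (p─⊥≡p p)))
∑∈-remove {x = suc x} (outside ∷ p) f (there x∈p) = ∑∈-remove p (f ∘ suc) x∈p
∑∈-remove {x = suc x} (inside  ∷ p) f (there x∈p) =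
  trans (cong (f zero +_) (∑∈-remove p (f ∘ suc) x∈p)) (x∙yz≈y∙xz (f zero) (f (suc x)) _)

∑∈-χ : ∀ {n} (p : Subset n) (f : Fin n → Bool) → ∑[ x ∈ p ] χ (f x) ≡ ∣ p ∩ tabulate f ∣
∑∈-χ []            f = refl
∑∈-χ (outside ∷ p) f = ∑∈-χ p (f ∘ suc)
∑∈-χ (inside  ∷ p) f with f zero
... | true  = cong suc (∑∈-χ p (f ∘ suc))
... | false = ∑∈-χ p (f ∘ suc)

∑∈-⊤ : ∀ {n} (f : Fin n → ℕ) → ∑∈ ⊤ f ≡ ∑[ x < n ] f x
∑∈-⊤ {zero}  f = refl
∑∈-⊤ {suc n} f = cong (f zero +_) (∑∈-⊤ (f ∘ suc))

*-∣∣≤∑∈ : ∀ {n} {c} (p : Subset n) (f : Fin n → ℕ) → (∀ {x} → x ∈ p → c ≤ f x) → c * ∣ p ∣ ≤ ∑∈ p f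
*-∣∣≤∑∈ {c = c} []            f c≤f = subst (_≤ 0) (sym (*-zeroʳ c)) z≤n
*-∣∣≤∑∈         (outside ∷ p) f c≤f = *-∣∣≤∑∈ p (f ∘ suc) (c≤f ∘ there)
*-∣∣≤∑∈ {c = c} (inside  ∷ p) f c≤f =
  subst (_≤ ∑∈ (inside ∷ p) f) (sym (*-suc c ∣ p ∣)) (+-mono-≤ (c≤f here) (*-∣∣≤∑∈ p (f ∘ suc) (c≤f ∘ there)))

∑∈-positive : ∀ {n} (p : Subset n) (f : Fin n → ℕ) → 0 < ∑∈ p f → ∃ λ x → x ∈ p × 0 < f x
∑∈-positive (outside ∷ p) f pos with ∑∈-positive p (f ∘ suc) pos
... | x , x∈p , fx>0 = suc x , there x∈p , fx>0
∑∈-positive (inside ∷ p) f pos with f zero in eq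
... | suc _ = zero , here , subst (0 <_) (sym eq) (s≤s z≤n)
... | zero with ∑∈-positive p (f ∘ suc) pos
...   | x , x∈p , fx>0 = suc x , there x∈p , fx>0


module _ {A : Set} {P : A → Set} (P? : Decidable P) where

  filter-filter : ∀ {Q : A → Set} (Q? : Decidable Q) xs → filter P? (filter Q? xs) ≡ filter (Q? ∩? P?) xs
  filter-filter Q? []       = refl
  filter-filter Q? (x ∷ xs) with does (Q? x)
  ... | false = filter-filter Q? xs
  ... | true with does (P? x)
  ...   | false = filter-filter Q? xs
  ...   | true  = cong (x ∷_) (filter-filter Q? xs)

  length-filter-tabulate : ∀ {m} (f : Fin m → A) →
                           length (filter P? (List.tabulate f)) ≡ ∑[ i < m ] χ (does (P? (f i)))
  length-filter-tabulate {zero}  f = refl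
  length-filter-tabulate {suc m} f with does (P? (f zero))
  ... | false = length-filter-tabulate (f ∘ suc)
  ... | true  = cong suc (length-filter-tabulate (f ∘ suc))

  length-filter-concat-tabulate : ∀ {m} (f : Fin m → List A) →
    length (filter P? (concat (List.tabulate f))) ≡ ∑[ i < m ] length (filter P? (f i))
  length-filter-concat-tabulate {zero}  f = refl
  length-filter-concat-tabulate {suc m} f = begin
    length (filter P? (f zero ++ rest))            ≡⟨ cong length (filter-++ P? (f zero) rest) ⟩
    length (filter P? (f zero) ++ filter P? rest)  ≡⟨ length-++ (filter P? (f zero)) ⟩
    length (filter P? (f zero)) + length (filter P? rest)
      ≡⟨ cong (length (filter P? (f zero)) +_) (length-filter-concat-tabulate (f ∘ suc)) ⟩
    ∑[ i < suc m ] length (filter P? (f i))        ∎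
    where
    open ≡-Reasoning
    rest : List A
    rest = concat (List.tabulate (f ∘ suc))

module _ {n : ℕ} (G : Graph n) where

  Adj-sym : ∀ {u v} → Adj G u v → Adj G v u
  Adj-sym {u} {v} uv = trans (adj-sym G v u) uv

  Adj-irrefl : ∀ {v} → ¬ Adj G v v
  Adj-irrefl {v} vv = contradiction (trans (sym vv) (adj-irrefl G v)) λ ()

  N : Fin n → Subset n
  N u = tabulate (adj G u)

  ∈N⁻ : ∀ {u v} → v ∈ N u → Adj G u v
  ∈N⁻ {u} {v} v∈Nu = trans (sym (lookup∘tabulate (adj G u) v)) ([]=⇒lookup v∈Nu)

  deg : Subset n → Fin n → ℕ
  deg S u = ∑[ w ∈ S ] χ (adj G u w)

  deg≡∣∩N∣ : ∀ S u → deg S u ≡ ∣ S ∩ N u ∣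
  deg≡∣∩N∣ S u = ∑∈-χ S (adj G u)

  degreeSum : Subset n → ℕ
  degreeSum S = ∑[ u ∈ S ] deg S u

  deg-remove-self : ∀ {S y} → y ∈ S → deg S y ≡ deg (S - y) y
  deg-remove-self {S} {y} y∈S = begin
    deg S y                       ≡⟨ ∑∈-remove S (χ ∘ adj G y) y∈S ⟩
    χ (adj G y y) + deg (S - y) y ≡⟨ cong (λ b → χ b + deg (S - y) y) (adj-irrefl G y) ⟩
    deg (S - y) y                 ∎
    where open ≡-Reasoning

  degreeSum-remove : ∀ {S y} → y ∈ S → degreeSum S ≡ 2 * deg S y + degreeSum (S - y)
  degreeSum-remove {S} {y} y∈S = begin
    degreeSum S
      ≡⟨ ∑∈-remove S (deg S) y∈S ⟩
    deg S y + ∑[ u ∈ S - y ] deg S u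
      ≡⟨ cong (deg S y +_) (∑∈-cong (S - y) (λ u → ∑∈-remove S (χ ∘ adj G u) y∈S)) ⟩
    deg S y + ∑[ u ∈ S - y ] (χ (adj G u y) + deg (S - y) u)
      ≡⟨ cong (deg S y +_) (∑∈-distrib-+ (S - y) (λ u → χ (adj G u y)) (deg (S - y))) ⟩
    deg S y + (∑[ u ∈ S - y ] χ (adj G u y) + degreeSum (S - y))
      ≡⟨ cong (λ k → deg S y + (k + degreeSum (S - y))) (∑∈-cong (S - y) (λ u → cong χ (adj-sym G u y))) ⟩
    deg S y + (deg (S - y) y + degreeSum (S - y))
      ≡⟨ cong (λ k → deg S y + (k + degreeSum (S - y))) (sym (deg-remove-self y∈S)) ⟩
    deg S y + (deg S y + degreeSum (S - y))
      ≡⟨ sym (+-assoc (deg S y) (deg S y) _) ⟩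
    deg S y + deg S y + degreeSum (S - y)
      ≡⟨ cong (λ k → deg S y + k + degreeSum (S - y)) (sym (+-identityʳ (deg S y))) ⟩
    2 * deg S y + degreeSum (S - y) ∎
    where open ≡-Reasoning

  χ-adj-split : ∀ u v → χ (adj G u v) ≡ χ (does (u <ᶠ? v) ∧ adj G u v) + χ (does (v <ᶠ? u) ∧ adj G v u)
  χ-adj-split u v with <-cmp u v
  ... | tri< u<v _ v≮u rewrite dec-true (u <ᶠ? v) u<v | dec-false (v <ᶠ? u) v≮u = sym (+-identityʳ _)
  ... | tri≈ u≮v refl _ rewrite dec-false (u <ᶠ? u) u≮v | adj-irrefl G u = refl
  ... | tri> u≮v _ v<u rewrite dec-false (u <ᶠ? v) u≮v | dec-true (v <ᶠ? u) v<u = cong χ (adj-sym G u v)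

  numEdges≡∑∑ : numEdges G ≡ ∑[ u < n ] ∑[ v < n ] χ (does (u <ᶠ? v) ∧ adj G u v)
  numEdges≡∑∑ = begin
    length (filter Adj? (filter Ordered? pairs))
      ≡⟨ cong length (filter-filter Adj? Ordered? pairs) ⟩
    length (filter (Ordered? ∩? Adj?) pairs)
      ≡⟨ cong (length ∘ filter (Ordered? ∩? Adj?)) pairs≡ ⟩
    length (filter (Ordered? ∩? Adj?) (concat (List.tabulate λ u → List.tabulate (u ,_))))
      ≡⟨ length-filter-concat-tabulate (Ordered? ∩? Adj?) (λ u → List.tabulate (u ,_)) ⟩
    ∑[ u < n ] length (filter (Ordered? ∩? Adj?) (List.tabulate (u ,_)))
      ≡⟨ sum-cong-≗ (λ u → length-filter-tabulate (Ordered? ∩? Adj?) (u ,_)) ⟩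
    ∑[ u < n ] ∑[ v < n ] χ (does (u <ᶠ? v) ∧ does (adj G u v ≟ true))
      ≡⟨ sum-cong-≗ (λ u → sum-cong-≗ (λ v → cong (λ b → χ (does (u <ᶠ? v) ∧ b)) (does-≟-true (adj G u v)))) ⟩
    ∑[ u < n ] ∑[ v < n ] χ (does (u <ᶠ? v) ∧ adj G u v) ∎
    where
    open ≡-Reasoning
    pairs : List (Fin n × Fin n)
    pairs = concatMap (λ u → List.map (u ,_) (allFin n)) (allFin n)
    pairs≡ : pairs ≡ concat (List.tabulate λ u → List.tabulate (u ,_))
    pairs≡ = cong concat (trans (map-tabulate id _) (tabulate-cong (λ u → map-tabulate id (u ,_))))
    Ordered? : Decidable {A = Fin n × Fin n} λ (u , v) → toℕ u < toℕ v
    Ordered? (u , v) = u <ᶠ? v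
    Adj? : Decidable {A = Fin n × Fin n} λ (u , v) → Adj G u v
    Adj? (u , v) = adj G u v ≟ true
    does-≟-true : ∀ b → does (b ≟ true) ≡ b
    does-≟-true true  = refl
    does-≟-true false = refl

  degreeSum-⊤ : degreeSum ⊤ ≡ 2 * numEdges G
  degreeSum-⊤ = begin
    degreeSum ⊤                                   ≡⟨ ∑∈-⊤ (deg ⊤) ⟩
    ∑[ u < n ] deg ⊤ u                            ≡⟨ sum-cong-≗ (λ u → ∑∈-⊤ (χ ∘ adj G u)) ⟩
    ∑[ u < n ] ∑[ v < n ] χ (adj G u v)           ≡⟨ sum-cong-≗ (λ u → sum-cong-≗ (χ-adj-split u)) ⟩
    ∑[ u < n ] ∑[ v < n ] (E u v + E v u)         ≡⟨ sum-cong-≗ (λ u → ∑-distrib-+ (E u) (λ v → E v u)) ⟩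
    ∑[ u < n ] (∑[ v < n ] E u v + ∑[ v < n ] E v u)
      ≡⟨ ∑-distrib-+ (λ u → ∑[ v < n ] E u v) (λ u → ∑[ v < n ] E v u) ⟩
    ∑[ u < n ] ∑[ v < n ] E u v + ∑[ u < n ] ∑[ v < n ] E v u
      ≡⟨ cong (∑[ u < n ] ∑[ v < n ] E u v +_) (∑-comm (λ u v → E v u)) ⟩
    ∑[ u < n ] ∑[ v < n ] E u v + ∑[ u < n ] ∑[ v < n ] E u v
      ≡⟨ cong₂ _+_ (sym numEdges≡∑∑) (trans (sym numEdges≡∑∑) (sym (+-identityʳ (numEdges G)))) ⟩
    2 * numEdges G ∎
    where
    open ≡-Reasoning
    E : Fin n → Fin n → ℕ
    E u v = χ (does (u <ᶠ? v) ∧ adj G u v)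

  WalkIn-mono : ∀ {S S′ u v} → S ⊆ S′ → WalkIn G S u v → WalkIn G S′ u v
  WalkIn-mono S⊆S′ (here u∈S)        = here (S⊆S′ u∈S)
  WalkIn-mono S⊆S′ (step u∈S uw walk) = step (S⊆S′ u∈S) uw (WalkIn-mono S⊆S′ walk)

  WalkIn-snoc : ∀ {S u v w} → WalkIn G S u v → Adj G v w → w ∈ S → WalkIn G S u w
  WalkIn-snoc (here u∈S)         vw w∈S = step u∈S vw (here w∈S)
  WalkIn-snoc (step u∈S uu′ walk) vw w∈S = step u∈S uu′ (WalkIn-snoc walk vw w∈S)

  ⁅⁆-connected : ∀ y → ConnectedIn G ⁅ y ⁆
  ⁅⁆-connected y u v u∈ v∈ with x∈⁅y⁆⇒x≡y y u∈ | x∈⁅y⁆⇒x≡y y v∈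
  ... | refl | refl = here u∈

  ∪⁅⁆-connected : ∀ {T u y} → ConnectedIn G T → u ∈ T → Adj G u y → ConnectedIn G (T ∪ ⁅ y ⁆)
  ∪⁅⁆-connected {T} {u} {y} T-conn u∈T uy a b a∈ b∈ with x∈p∪q⁻ T ⁅ y ⁆ a∈ | x∈p∪q⁻ T ⁅ y ⁆ b∈
  ... | inj₁ a∈T | inj₁ b∈T = WalkIn-mono (p⊆p∪q ⁅ y ⁆) (T-conn a b a∈T b∈T)
  ... | inj₁ a∈T | inj₂ b∈y rewrite x∈⁅y⁆⇒x≡y y b∈y =
    WalkIn-snoc (WalkIn-mono (p⊆p∪q ⁅ y ⁆) (T-conn a u a∈T u∈T)) uy (q⊆p∪q T ⁅ y ⁆ (x∈⁅x⁆ y))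
  ... | inj₂ a∈y | inj₁ b∈T rewrite x∈⁅y⁆⇒x≡y y a∈y =
    step (q⊆p∪q T ⁅ y ⁆ (x∈⁅x⁆ y)) (Adj-sym uy) (WalkIn-mono (p⊆p∪q ⁅ y ⁆) (T-conn u b u∈T b∈T))
  ... | inj₂ a∈y | inj₂ b∈y rewrite x∈⁅y⁆⇒x≡y y a∈y | x∈⁅y⁆⇒x≡y y b∈y = here (q⊆p∪q T ⁅ y ⁆ (x∈⁅x⁆ y))

  ModelIn : Subset n → ℕ → Set
  ModelIn S t = Σ[ M ∈ DominatingModel G t ] (∀ i → DominatingModel.T M i ⊆ S)

  ModelIn-mono : ∀ {S S′ t} → S ⊆ S′ → ModelIn S t → ModelIn S′ t
  ModelIn-mono S⊆S′ (M , parts⊆S) = M , λ i → S⊆S′ ∘ parts⊆S i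

  ⁅⁆-model : ∀ v → ModelIn ⁅ v ⁆ 1
  ⁅⁆-model v = record
    { T          = λ _ → ⁅ v ⁆
    ; nonEmpty   = λ _ → v , x∈⁅x⁆ v
    ; connected  = λ _ → ⁅⁆-connected v
    ; disjoint   = λ { zero zero 0≢0 → contradiction refl 0≢0 }
    ; dominating = λ { zero zero () }
    } , λ _ → id

  prepend : ∀ {t T D} → NonEmpty T → ConnectedIn G T → (∀ {v} → v ∈ T → v ∉ D) →
            (∀ {v} → v ∈ D → ∃ λ u → u ∈ T × Adj G u v) → ModelIn D t → ModelIn (T ∪ D) (suc t)
  prepend {t} {T} {D} T≠∅ T-conn T∩D≡∅ T↠D (M , parts⊆D) = model , parts⊆
    where
    module M = DominatingModel M
    parts : Fin (suc t) → Subset n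
    parts zero    = T
    parts (suc i) = M.T i
    parts⊆ : ∀ i → parts i ⊆ T ∪ D
    parts⊆ zero    = p⊆p∪q D
    parts⊆ (suc i) = q⊆p∪q T D ∘ parts⊆D i
    disjoint : ∀ i j → i ≢ j → ∀ v → v ∈ parts i → v ∉ parts j
    disjoint zero    zero    0≢0 = contradiction refl 0≢0
    disjoint zero    (suc j) _   v v∈T v∈Mj = T∩D≡∅ v∈T (parts⊆D j v∈Mj)
    disjoint (suc i) zero    _   v v∈Mi v∈T = T∩D≡∅ v∈T (parts⊆D i v∈Mi)
    disjoint (suc i) (suc j) i≢j = M.disjoint i j (i≢j ∘ cong suc)
    dominating : ∀ i j → toℕ i < toℕ j → ∀ v → v ∈ parts j → ∃ λ u → u ∈ parts i × Adj G u v
    dominating zero    (suc j) _         v v∈Mj = T↠D (parts⊆D j v∈Mj)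
    dominating (suc i) (suc j) (s≤s i<j) = M.dominating i j i<j
    model : DominatingModel G (suc t)
    model = record
      { T          = parts
      ; nonEmpty   = λ { zero → T≠∅ ; (suc i) → M.nonEmpty i }
      ; connected  = λ { zero → T-conn ; (suc i) → M.connected i }
      ; disjoint   = disjoint
      ; dominating = dominating
      }

  edge-model : ∀ {u w} → Adj G u w → ModelIn (⁅ u ⁆ ∪ ⁅ w ⁆) 2
  edge-model {u} {w} uw = prepend (u , x∈⁅x⁆ u) (⁅⁆-connected u) u≠w u↠w (⁅⁆-model w)
    where
    u≠w : ∀ {v} → v ∈ ⁅ u ⁆ → v ∉ ⁅ w ⁆
    u≠w v∈u v∈w rewrite x∈⁅y⁆⇒x≡y u v∈u | x∈⁅y⁆⇒x≡y w v∈w = Adj-irrefl uw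
    u↠w : ∀ {v} → v ∈ ⁅ w ⁆ → ∃ λ u′ → u′ ∈ ⁅ u ⁆ × Adj G u′ v
    u↠w v∈w rewrite x∈⁅y⁆⇒x≡y w v∈w = u , x∈⁅x⁆ u , uw

  MinDegree : Subset n → ℕ → Set
  MinDegree D d = ∀ {v} → v ∈ D → d ≤ deg D v

  record SearchState (S : Subset n) (d : ℕ) : Set where
    field
      root rest core : Subset n
      root⊆S         : root ⊆ S
      rest⊆S         : rest ⊆ S
      root∩rest≡∅    : ∀ {v} → v ∈ root → v ∉ rest
      core⊆rest      : core ⊆ rest
      root↠core      : ∀ {v} → v ∈ core → ∃ λ u → u ∈ root × Adj G u v
      root-nonempty  : NonEmpty root
      root-connected : ConnectedIn G root
      potential      : 2 * d * suc ∣ rest ∣ ≤ degreeSum rest + 2 * ∣ core ∣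

  open SearchState public

  start : ∀ {S d R y} → R ⊆ S → y ∈ R → 2 * d * ∣ R ∣ ≤ degreeSum R → SearchState S d
  start {S} {d} {R} {y} R⊆S y∈R dense = record
    { root           = ⁅ y ⁆
    ; rest           = R - y
    ; core           = R ∩ N y
    ; root⊆S         = R⊆S ∘ x∈p⇒⁅x⁆⊆p y∈R
    ; rest⊆S         = R⊆S ∘ p─q⊆p R ⁅ y ⁆
    ; root∩rest≡∅    = λ v∈y v∈R-y → x∈p─q⇒x∉q R ⁅ y ⁆ v∈R-y v∈y
    ; core⊆rest      = core⊆rest′
    ; root↠core      = λ v∈core → y , x∈⁅x⁆ y , ∈N⁻ (proj₂ (x∈p∩q⁻ R (N y) v∈core))
    ; root-nonempty  = y , x∈⁅x⁆ y
    ; root-connected = ⁅⁆-connected y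
    ; potential      = potential′
    }
    where
    core⊆rest′ : R ∩ N y ⊆ R - y
    core⊆rest′ v∈core with x∈p∩q⁻ R (N y) v∈core
    ... | v∈R , v∈Ny = x∈p∧x≢y⇒x∈p-y v∈R λ { refl → Adj-irrefl (∈N⁻ v∈Ny) }
    potential′ : 2 * d * suc ∣ R - y ∣ ≤ degreeSum (R - y) + 2 * ∣ R ∩ N y ∣
    potential′ = begin
      2 * d * suc ∣ R - y ∣                 ≤⟨ *-monoʳ-≤ (2 * d) (x∈p⇒∣p-x∣<∣p∣ y∈R) ⟩
      2 * d * ∣ R ∣                         ≤⟨ dense ⟩
      degreeSum R                           ≡⟨ degreeSum-remove y∈R ⟩
      2 * deg R y + degreeSum (R - y)       ≡⟨ +-comm (2 * deg R y) _ ⟩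
      degreeSum (R - y) + 2 * deg R y       ≡⟨ cong (λ k → degreeSum (R - y) + 2 * k) (deg≡∣∩N∣ R y) ⟩
      degreeSum (R - y) + 2 * ∣ R ∩ N y ∣   ∎
      where open ≤-Reasoning

  potential-after-move : ∀ {d R D y} → y ∈ R → deg D y < d →
                         2 * d * suc ∣ R ∣ ≤ degreeSum R + 2 * ∣ D ∣ →
                         2 * d * suc ∣ R - y ∣ ≤ degreeSum (R - y) + 2 * ∣ (D ∪ R ∩ N y) - y ∣
  potential-after-move {d} {R} {D} {y} y∈R small potential = +-cancelʳ-≤ (2 * d) _ _ (begin
    2 * d * suc ∣ R - y ∣ + 2 * d                        ≡⟨ +-comm _ (2 * d) ⟩
    2 * d + 2 * d * suc ∣ R - y ∣                        ≡⟨ *-suc (2 * d) (suc ∣ R - y ∣) ⟨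
    2 * d * suc (suc ∣ R - y ∣)                          ≤⟨ *-monoʳ-≤ (2 * d) (s≤s (x∈p⇒∣p-x∣<∣p∣ y∈R)) ⟩
    2 * d * suc ∣ R ∣                                    ≤⟨ potential ⟩
    degreeSum R + 2 * ∣ D ∣                              ≡⟨ cong (_+ 2 * ∣ D ∣) (degreeSum-remove y∈R) ⟩
    2 * deg R y + degreeSum (R - y) + 2 * ∣ D ∣          ≡⟨ regroup (deg R y) (degreeSum (R - y)) ∣ D ∣ ⟩
    degreeSum (R - y) + 2 * (∣ D ∣ + deg R y)            ≤⟨ +-monoʳ-≤ (degreeSum (R - y)) (*-monoʳ-≤ 2 core-count) ⟩
    degreeSum (R - y) + 2 * (∣ D′ ∣ + 1 + deg D y)       ≡⟨ split (degreeSum (R - y)) ∣ D′ ∣ (deg D y) ⟩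
    degreeSum (R - y) + 2 * ∣ D′ ∣ + 2 * suc (deg D y)   ≤⟨ +-monoʳ-≤ (degreeSum (R - y) + 2 * ∣ D′ ∣) (*-monoʳ-≤ 2 small) ⟩
    degreeSum (R - y) + 2 * ∣ D′ ∣ + 2 * d               ∎)
    where
    open ≤-Reasoning
    D′ : Subset n
    D′ = (D ∪ R ∩ N y) - y
    core-count : ∣ D ∣ + deg R y ≤ ∣ D′ ∣ + 1 + deg D y
    core-count rewrite deg≡∣∩N∣ R y | deg≡∣∩N∣ D y = ∣p∣+∣q∩r∣≤∣p∪q∩r-x∣+1+∣p∩r∣ D R (N y) y
    regroup : ∀ k e δ → 2 * k + e + 2 * δ ≡ e + 2 * (δ + k)
    regroup = solve-∀
    split : ∀ e δ j → e + 2 * (δ + 1 + j) ≡ e + 2 * δ + 2 * suc j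
    split = solve-∀

  move : ∀ {S d} (s : SearchState S d) {y} → y ∈ core s → deg (core s) y < d → SearchState S d
  move s {y} y∈D small = record
    { root           = root s ∪ ⁅ y ⁆
    ; rest           = R - y
    ; core           = D′
    ; root⊆S         = p⊆r⇒q⊆r⇒p∪q⊆r (root⊆S s) (rest⊆S s ∘ x∈p⇒⁅x⁆⊆p y∈R)
    ; rest⊆S         = rest⊆S s ∘ p─q⊆p R ⁅ y ⁆
    ; root∩rest≡∅    = root′∩rest′≡∅
    ; core⊆rest      = λ v∈D′ → x∈p∧x∉q⇒x∈p─q (D∪R∩Ny⊆R (p─q⊆p _ ⁅ y ⁆ v∈D′)) (x∈p─q⇒x∉q _ ⁅ y ⁆ v∈D′)
    ; root↠core      = root′↠core′
    ; root-nonempty  = proj₁ (root-nonempty s) , p⊆p∪q ⁅ y ⁆ (proj₂ (root-nonempty s))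
    ; root-connected = ∪⁅⁆-connected (root-connected s) (proj₁ (proj₂ (root↠core s y∈D)))
                                                         (proj₂ (proj₂ (root↠core s y∈D)))
    ; potential      = potential-after-move {D = D} y∈R small (potential s)
    }
    where
    R D D′ : Subset n
    R  = rest s
    D  = core s
    D′ = (D ∪ R ∩ N y) - y
    y∈R : y ∈ R
    y∈R = core⊆rest s y∈D
    D∪R∩Ny⊆R : D ∪ R ∩ N y ⊆ R
    D∪R∩Ny⊆R = p⊆r⇒q⊆r⇒p∪q⊆r (core⊆rest s) (p∩q⊆p R (N y))
    root′∩rest′≡∅ : ∀ {v} → v ∈ root s ∪ ⁅ y ⁆ → v ∉ R - y
    root′∩rest′≡∅ v∈root′ v∈R-y with x∈p∪q⁻ (root s) ⁅ y ⁆ v∈root′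
    ... | inj₁ v∈root = root∩rest≡∅ s v∈root (p─q⊆p R ⁅ y ⁆ v∈R-y)
    ... | inj₂ v∈y    = x∈p─q⇒x∉q R ⁅ y ⁆ v∈R-y v∈y
    root′↠core′ : ∀ {v} → v ∈ D′ → ∃ λ u → u ∈ root s ∪ ⁅ y ⁆ × Adj G u v
    root′↠core′ v∈D′ with x∈p∪q⁻ D (R ∩ N y) (p─q⊆p _ ⁅ y ⁆ v∈D′)
    ... | inj₁ v∈D    = let (u , u∈root , uv) = root↠core s v∈D in u , p⊆p∪q ⁅ y ⁆ u∈root , uv
    ... | inj₂ v∈R∩Ny = y , q⊆p∪q (root s) ⁅ y ⁆ (x∈⁅x⁆ y) , ∈N⁻ (proj₂ (x∈p∩q⁻ R (N y) v∈R∩Ny))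

  empty-core⇒dense-rest : ∀ {S d} → 1 ≤ d → (s : SearchState S d) → Empty (core s) →
                          ∃ λ y → y ∈ rest s × 2 * d * ∣ rest s ∣ ≤ degreeSum (rest s)
  empty-core⇒dense-rest {d = d} d≥1 s core≡∅ =
    let (y , y∈R , _) = ∑∈-positive (rest s) (deg (rest s)) (≤-trans (positive d≥1) dense-rest)
    in y , y∈R , ≤-trans (*-monoʳ-≤ (2 * d) (n≤1+n ∣ rest s ∣)) dense-rest
    where
    positive : 1 ≤ d → 0 < 2 * d * suc ∣ rest s ∣
    positive (s≤s z≤n) = s≤s z≤n
    dense-rest : 2 * d * suc ∣ rest s ∣ ≤ degreeSum (rest s)
    dense-rest = subst (2 * d * suc ∣ rest s ∣ ≤_) no-core (potential s)
      where
      no-core : degreeSum (rest s) + 2 * ∣ core s ∣ ≡ degreeSum (rest s)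
      no-core rewrite Empty-unique core≡∅ | ∣⊥∣≡0 n = +-identityʳ (degreeSum (rest s))

  FinalState : Subset n → ℕ → Set
  FinalState S d = Σ[ s ∈ SearchState S d ] (NonEmpty (core s) × MinDegree (core s) d)

  search : ∀ {S d} → 1 ≤ d → (s : SearchState S d) → Acc _<_ ∣ rest s ∣ → FinalState S d
  search {d = d} d≥1 s (acc rs) with any? (λ v → v ∈? core s ×-dec deg (core s) v <? d)
  ... | yes (y , y∈D , small) = search d≥1 (move s y∈D small) (rs (x∈p⇒∣p-x∣<∣p∣ (core⊆rest s y∈D)))
  ... | no no-small with nonempty? (core s)
  ...   | yes core≠∅ = s , core≠∅ , λ v∈D → ≮⇒≥ λ small → no-small (_ , v∈D , small)
  ...   | no core≡∅ with empty-core⇒dense-rest d≥1 s core≡∅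
  ...     | y , y∈R , dense = search d≥1 (start (rest⊆S s) y∈R dense) (rs (x∈p⇒∣p-x∣<∣p∣ y∈R))

  dense⇒finalState : ∀ {S d} → 1 ≤ d → NonEmpty S → 2 * d * ∣ S ∣ ≤ degreeSum S → FinalState S d
  dense⇒finalState d≥1 (v , v∈S) dense = search d≥1 (start id v∈S dense) (<-wellFounded _)

  degreeSum>0⇒edge : ∀ {S} → 0 < degreeSum S → ∃ λ u → ∃ λ w → u ∈ S × w ∈ S × Adj G u w
  degreeSum>0⇒edge {S} pos =
    let (u , u∈S , deg>0) = ∑∈-positive S (deg S) pos
        (w , w∈S , χ>0)   = ∑∈-positive S (χ ∘ adj G u) deg>0
    in u , w , u∈S , w∈S , χ>0⇒true χ>0
    where
    χ>0⇒true : ∀ {b} → 0 < χ b → b ≡ true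
    χ>0⇒true {true} _ = refl

  dense⇒model : ∀ k {S} → NonEmpty S → 2 ^ k * ∣ S ∣ ≤ degreeSum S → ModelIn S (2 + k)
  dense⇒model zero {S} (v , v∈S) dense =
    let (u , w , u∈S , w∈S , uw) = degreeSum>0⇒edge (≤-trans ∣S∣>0 (subst (_≤ degreeSum S) (*-identityˡ ∣ S ∣) dense))
    in ModelIn-mono (p⊆r⇒q⊆r⇒p∪q⊆r (x∈p⇒⁅x⁆⊆p u∈S) (x∈p⇒⁅x⁆⊆p w∈S)) (edge-model uw)
    where
    ∣S∣>0 : 0 < ∣ S ∣
    ∣S∣>0 = ≤-trans (s≤s z≤n) (x∈p⇒∣p-x∣<∣p∣ v∈S)
  dense⇒model (suc k) S≠∅ dense with dense⇒finalState (m^n>0 2 k) S≠∅ dense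
  ... | s , core≠∅ , min-deg =
    ModelIn-mono (p⊆r⇒q⊆r⇒p∪q⊆r (root⊆S s) (rest⊆S s ∘ core⊆rest s))
      (prepend (root-nonempty s) (root-connected s)
               (λ v∈root v∈core → root∩rest≡∅ s v∈root (core⊆rest s v∈core)) (root↠core s)
               (dense⇒model k core≠∅ (*-∣∣≤∑∈ (core s) (deg (core s)) min-deg)))

theorem16 : (t : ℕ) → 2 ≤ t → (n : ℕ) → (G : Graph (suc n)) →
    (2 ^ (t ∸ 2)) * suc n ≤ 2 * numEdges G →
    DominatingModel G t
theorem16 (suc (suc k)) (s≤s (s≤s z≤n)) n G dense = proj₁ (dense⇒model G k (zero , ∈⊤) dense′)
  where
  dense′ : 2 ^ k * ∣ ⊤ {suc n} ∣ ≤ degreeSum G ⊤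
  dense′ = subst₂ _≤_ (cong (2 ^ k *_) (sym (∣⊤∣≡n (suc n)))) (sym (degreeSum-⊤ G)) dense
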